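{- Let $G$ be a bipartite graph with partite sets $A$ and $B$, and let $M$ be a maximum matching in $G$. If $D(M)$ is acyclic, then every maximum matching in $G$ arises from $M$ by a (possibly empty) sequence of edge exchanges.
   Context: Graphs are finite and simple. For a bipartite graph $G$ with (fixed) partite sets $A$, $B$ and a matching $M$, let $D(M)$ be the digraph with vertex set $V(G)$ and arcs $(a,b)$ for $a\in A$, $b\in B$, $ab\in E(G)\setminus M$, and $(b,a)$ for $a\in A$, $b\in B$, $ab\in M$. Edge exchange: if $M$ is a maximum matching, $a\in A$ is not covered by $M$, and $a'b'\in M$ ($a'\in A$, $b'\in B$) with $b'$ adjacent to $a$, then $(M\setminus\{a'b'\})\cup\{ab'\}$ is said to arise from $M$ by an edge exchange; similarly, if $b\in B$ is not covered by $M$ and $a'b'\in M$ with $a'$ adjacent to $b$, then $(M\setminus\{a'b'\})\cup\{a'b\}$ arises from $M$ by an edge exchange. -}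

module Defs where

open import Data.Nat using (ℕ; _≤_)
open import Data.Fin using (Fin)
open import Data.Bool using (Bool; true; false; if_then_else_)
open import Data.List using (List; map; allFin)
open import Data.Nat.ListAction using (sum)
open import Data.Product using (Σ; ∃; _×_; _,_)
open import Data.Sum using (_⊎_; inj₁; inj₂)
open import Relation.Nullary using (¬_)
open import Relation.Binary.PropositionalEquality using (_≡_)
open import Relation.Binary.Construct.Closure.Transitive using (TransClosure)
open import Relation.Binary.Construct.Closure.ReflexiveTransitive using (Star)

-- A bipartite graph with partite sets A = Fin m and B = Fin n, given by its
-- bipartite adjacency relation: E a b ≡ true iff ab is an edge.
BipGraph : ℕ → ℕ → Set
BipGraph m n = Fin m → Fin n → Bool

EdgeSet : ℕ → ℕ → Set
EdgeSet m n = Fin m → Fin n → Bool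

module _ {m n : ℕ} (G : BipGraph m n) where

  IsMatching : EdgeSet m n → Set
  IsMatching M =
    (∀ a b → M a b ≡ true → G a b ≡ true) ×
    (∀ a b b′ → M a b ≡ true → M a b′ ≡ true → b ≡ b′) ×
    (∀ a a′ b → M a b ≡ true → M a′ b ≡ true → a ≡ a′)

  size : EdgeSet m n → ℕ
  size M = sum (map (λ a → sum (map (λ b → if M a b then 1 else 0) (allFin n))) (allFin m))

  IsMaximumMatching : EdgeSet m n → Set
  IsMaximumMatching M = IsMatching M × (∀ M′ → IsMatching M′ → size M′ ≤ size M)

  data DArc (M : EdgeSet m n) : Fin m ⊎ Fin n → Fin m ⊎ Fin n → Set where
    a→b : ∀ a b → G a b ≡ true → M a b ≡ false → DArc M (inj₁ a) (inj₂ b)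
    b→a : ∀ a b → M a b ≡ true → DArc M (inj₂ b) (inj₁ a)

  -- D(M) is acyclic: there is no closed directed walk of positive length
  -- (equivalently, no directed cycle).
  Acyclic : EdgeSet m n → Set
  Acyclic M = ∀ v → ¬ TransClosure (DArc M) v v

  UncoveredA : EdgeSet m n → Fin m → Set
  UncoveredA M a = ∀ b → M a b ≡ false

  UncoveredB : EdgeSet m n → Fin n → Set
  UncoveredB M b = ∀ a → M a b ≡ false

  data Exchange (M M′ : EdgeSet m n) : Set where
    exchA : IsMaximumMatching M →
            ∀ a a′ b′ → UncoveredA M a → M a′ b′ ≡ true → G a b′ ≡ true →
            (∀ x y → M′ x y ≡ true →
               (M x y ≡ true × ¬ (x ≡ a′ × y ≡ b′)) ⊎ (x ≡ a × y ≡ b′)) →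
            (∀ x y → (M x y ≡ true × ¬ (x ≡ a′ × y ≡ b′)) ⊎ (x ≡ a × y ≡ b′) →
               M′ x y ≡ true) →
            Exchange M M′
    exchB : IsMaximumMatching M →
            ∀ b a′ b′ → UncoveredB M b → M a′ b′ ≡ true → G a′ b ≡ true →
            (∀ x y → M′ x y ≡ true →
               (M x y ≡ true × ¬ (x ≡ a′ × y ≡ b′)) ⊎ (x ≡ a′ × y ≡ b)) →
            (∀ x y → (M x y ≡ true × ¬ (x ≡ a′ × y ≡ b′)) ⊎ (x ≡ a′ × y ≡ b) →
               M′ x y ≡ true) →
            Exchange M M′

  ArisesByExchanges : EdgeSet m n → EdgeSet m n → Set
  ArisesByExchanges M M′ =
    ∃ λ M″ → Star Exchange M M″ × (∀ x y → M″ x y ≡ M′ x y)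

module Submission where

-- Call Diff X Y the digraph on A ⊎ B with an arc a → b for every
-- edge ab of Y ∖ X and an arc b → a for every edge ab of X ∖ Y; for X = M it is
-- a subdigraph of D(M).  We show, by induction on |X Δ Y|, that every maximum
-- matching Y arises by exchanges from every maximum matching X whose Diff X Y
-- is acyclic.  If X ≠ Y, the finite acyclic digraph Diff X Y has a source s
-- (a vertex with an outgoing but no incoming arc).
--  * s = a₀ ∈ A: a₀ is uncovered by X, its Y-partner b₁ is covered by X (else
--    X + a₀b₁ would be a larger matching), and exchanging a₁b₁ for a₀b₁ brings
--    X one edge closer to Y.
--  * s = b₀ ∈ B: symmetrically, exchanging a₁b₁ ∈ Y for a₁b₀ brings Y one edge
--    closer to X; we reach the new matching from X and undo that exchange.
-- In both cases the new pair still has an acyclic difference digraph.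

open import Defs
open import Data.Nat using (ℕ; zero; suc; _+_; _≤_; _<_; z≤n)
open import Data.Nat.Properties
  using ( +-mono-≤; +-suc; ≤-refl; ≤-reflexive; <⇒≤; <-≤-trans; ≤-pred; n<1+n; <-irrefl
        ; m<1+n⇒m<n∨m≡n; module ≤-Reasoning)
open import Data.Fin using (Fin; zero; suc; toℕ; join; splitAt; _≟_)
open import Data.Fin.Properties using (pigeonhole; any?; splitAt-join; toℕ<n; suc-injective)
open import Data.Bool using (Bool; true; false; if_then_else_; _xor_)
open import Data.Bool.Properties using (xor-same; ¬-not) renaming (_≟_ to _≟ᵇ_)
open import Data.List using (map; allFin; tabulate)
open import Data.List.Properties using (map-tabulate)
open import Data.Nat.ListAction using (sum)
open import Data.Product using (∃; ∃₂; _×_; _,_; proj₁; proj₂; uncurry′)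
open import Data.Sum using (_⊎_; inj₁; inj₂)
open import Data.Empty using (⊥; ⊥-elim)
open import Relation.Nullary using (¬_; Dec; yes; no; _×-dec_)
open import Relation.Nullary.Decidable using (¬?; decidable-stable)
open import Relation.Binary.PropositionalEquality
open import Relation.Binary.Construct.Closure.Transitive using (TransClosure; [_]; _∷_)
open import Relation.Binary.Construct.Closure.ReflexiveTransitive using (ε; _◅_; _◅◅_)
open import Function using (_∘_; id)

not-both : ∀ {b} → b ≡ true → b ≡ false → ⊥
not-both refl ()

bool-ext : ∀ {u v} → (u ≡ true → v ≡ true) → (v ≡ true → u ≡ true) → u ≡ v
bool-ext {false} {false} _ _ = refl
bool-ext {false} {true} _ v⇒u = v⇒u refl
bool-ext {true} u⇒v _ = sym (u⇒v refl)

xor-differ : ∀ {u v} → u xor v ≡ true → ¬ u ≡ v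
xor-differ {u} t refl = not-both t (xor-same u)

differ-xor : ∀ {u v} → ¬ u ≡ v → u xor v ≡ true
differ-xor {false} {false} u≢v = ⊥-elim (u≢v refl)
differ-xor {false} {true} _ = refl
differ-xor {true} {false} _ = refl
differ-xor {true} {true} u≢v = ⊥-elim (u≢v refl)

-- Finite sums f 0 + … + f (k-1), computed by recursion on k so that they can
-- be compared index by index.
sumFin : ∀ k → (Fin k → ℕ) → ℕ
sumFin zero f = 0
sumFin (suc k) f = f zero + sumFin k (f ∘ suc)

sum-allFin : ∀ k (f : Fin k → ℕ) → sum (map f (allFin k)) ≡ sumFin k f
sum-allFin k f = trans (cong sum (map-tabulate id f)) (sum-tabulate k f)
  where
  sum-tabulate : ∀ k (f : Fin k → ℕ) → sum (tabulate f) ≡ sumFin k f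
  sum-tabulate zero f = refl
  sum-tabulate (suc k) f = cong (f zero +_) (sum-tabulate k (f ∘ suc))

sumFin-cong : ∀ {k} {f g : Fin k → ℕ} → (∀ i → f i ≡ g i) → sumFin k f ≡ sumFin k g
sumFin-cong {zero} _ = refl
sumFin-cong {suc k} f≡g = cong₂ _+_ (f≡g zero) (sumFin-cong (f≡g ∘ suc))

sumFin-mono : ∀ {k} {f g : Fin k → ℕ} → (∀ i → f i ≤ g i) → sumFin k f ≤ sumFin k g
sumFin-mono {zero} _ = z≤n
sumFin-mono {suc k} f≤g = +-mono-≤ (f≤g zero) (sumFin-mono (f≤g ∘ suc))

sumFin-point : ∀ {k} (f g : Fin k → ℕ) (i : Fin k) → g i ≡ suc (f i) →
               (∀ j → ¬ j ≡ i → f j ≡ g j) → sumFin k g ≡ suc (sumFin k f)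
sumFin-point f g zero gᵢ elsewhere =
  cong₂ _+_ gᵢ (sym (sumFin-cong (λ j → elsewhere (suc j) λ ())))
sumFin-point f g (suc i) gᵢ elsewhere =
  trans (cong₂ _+_ (sym (elsewhere zero λ ()))
                   (sumFin-point (f ∘ suc) (g ∘ suc) i gᵢ
                      (λ j j≢i → elsewhere (suc j) (j≢i ∘ suc-injective))))
        (+-suc (f zero) _)

module _ {m n : ℕ} where

  _⊆_ : EdgeSet m n → EdgeSet m n → Set
  P ⊆ Q = ∀ a b → P a b ≡ true → Q a b ≡ true

  _≐_ : EdgeSet m n → EdgeSet m n → Set
  P ≐ Q = ∀ a b → P a b ≡ Q a b

  count : Bool → ℕ
  count b = if b then 1 else 0

  card : EdgeSet m n → ℕ
  card M = sumFin m λ a → sumFin n λ b → count (M a b)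

  card-size : ∀ (G : BipGraph m n) M → size G M ≡ card M
  card-size G M = trans (sum-allFin m _) (sumFin-cong λ a → sum-allFin n λ b → count (M a b))

  card-≐ : ∀ {P Q} → P ≐ Q → card P ≡ card Q
  card-≐ P≐Q = sumFin-cong λ a → sumFin-cong λ b → cong count (P≐Q a b)

  card-mono : ∀ {P Q} → P ⊆ Q → card P ≤ card Q
  card-mono P⊆Q = sumFin-mono λ a → sumFin-mono λ b → count-mono (P⊆Q a b)
    where
    count-mono : ∀ {u v} → (u ≡ true → v ≡ true) → count u ≤ count v
    count-mono {false} _ = z≤n
    count-mono {true} u⇒v rewrite u⇒v refl = ≤-refl

  card-point : ∀ {P Q} a b → P a b ≡ false → Q a b ≡ true →
               (∀ x y → ¬ (x ≡ a × y ≡ b) → P x y ≡ Q x y) → card Q ≡ suc (card P)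
  card-point {P} {Q} a b Pab Qab elsewhere =
    sumFin-point _ _ a
      (sumFin-point _ _ b (subst₂ (λ u v → count u ≡ suc (count v)) (sym Qab) (sym Pab) refl)
         (λ y y≢b → cong count (elsewhere a y λ (_ , y≡b) → y≢b y≡b)))
      (λ x x≢a → sumFin-cong λ y → cong count (elsewhere x y λ (x≡a , _) → x≢a x≡a))

  update : EdgeSet m n → Fin m → Fin n → Bool → EdgeSet m n
  update M a b v x y with x ≟ a | y ≟ b
  ... | yes _ | yes _ = v
  ... | _ | _ = M x y

  update-view : ∀ M a b v x y →
                (x ≡ a × y ≡ b × update M a b v x y ≡ v) ⊎
                (¬ (x ≡ a × y ≡ b) × update M a b v x y ≡ M x y)
  update-view M a b v x y with x ≟ a | y ≟ b
  ... | yes x≡a | yes y≡b = inj₁ (x≡a , y≡b , refl)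
  ... | yes _ | no y≢b = inj₂ ((λ (_ , y≡b) → y≢b y≡b) , refl)
  ... | no x≢a | _ = inj₂ ((λ (x≡a , _) → x≢a x≡a) , refl)

  update-hit : ∀ M a b v → update M a b v a b ≡ v
  update-hit M a b v with update-view M a b v a b
  ... | inj₁ (_ , _ , hit) = hit
  ... | inj₂ (miss , _) = ⊥-elim (miss (refl , refl))

  update-miss : ∀ M a b v x y → ¬ (x ≡ a × y ≡ b) → update M a b v x y ≡ M x y
  update-miss M a b v x y miss with update-view M a b v x y
  ... | inj₁ (x≡a , y≡b , _) = ⊥-elim (miss (x≡a , y≡b))
  ... | inj₂ (_ , same) = same

  delete-⊆ : ∀ M a b → update M a b false ⊆ M
  delete-⊆ M a b x y t with update-view M a b false x y
  ... | inj₁ (_ , _ , hit) = ⊥-elim (not-both t hit)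
  ... | inj₂ (_ , same) = trans (sym same) t

  card-insert : ∀ P a b → P a b ≡ false → card (update P a b true) ≡ suc (card P)
  card-insert P a b Pab =
    card-point a b Pab (update-hit P a b true) (λ x y miss → sym (update-miss P a b true x y miss))

  card-delete : ∀ P a b → P a b ≡ true → card P ≡ suc (card (update P a b false))
  card-delete P a b Pab = card-point a b (update-hit P a b false) Pab (update-miss P a b false)

  card-strict : ∀ {P Q} a b → P ⊆ Q → P a b ≡ false → Q a b ≡ true → card P < card Q
  card-strict {P} {Q} a b P⊆Q Pab Qab =
    subst (_≤ card Q) (card-insert P a b Pab) (card-mono P+ab⊆Q)
    where
    P+ab⊆Q : update P a b true ⊆ Q
    P+ab⊆Q x y t with update-view P a b true x y
    ... | inj₁ (refl , refl , _) = Qab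
    ... | inj₂ (_ , same) = P⊆Q x y (trans (sym same) t)

  swap : EdgeSet m n → Fin m → Fin n → Fin m → Fin n → EdgeSet m n
  swap M p q p′ q′ = update (update M p q false) p′ q′ true

  -- M′ consists of the edges of M other than pq, together with p′q′: the
  -- description of the new matching used in the definition of Exchange.
  SwapOf : EdgeSet m n → Fin m → Fin n → Fin m → Fin n → EdgeSet m n → Set
  SwapOf M p q p′ q′ M′ =
    (∀ x y → M′ x y ≡ true → (M x y ≡ true × ¬ (x ≡ p × y ≡ q)) ⊎ (x ≡ p′ × y ≡ q′)) ×
    (∀ x y → (M x y ≡ true × ¬ (x ≡ p × y ≡ q)) ⊎ (x ≡ p′ × y ≡ q′) → M′ x y ≡ true)

  swap-spec : ∀ M p q p′ q′ → SwapOf M p q p′ q′ (swap M p q p′ q′)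
  swap-spec M p q p′ q′ = forward , backward
    where
    forward : ∀ x y → swap M p q p′ q′ x y ≡ true →
              (M x y ≡ true × ¬ (x ≡ p × y ≡ q)) ⊎ (x ≡ p′ × y ≡ q′)
    forward x y t with update-view (update M p q false) p′ q′ true x y
    ... | inj₁ (x≡p′ , y≡q′ , _) = inj₂ (x≡p′ , y≡q′)
    ... | inj₂ (_ , same) with update-view M p q false x y
    ...   | inj₁ (_ , _ , hit) = ⊥-elim (not-both (trans (sym same) t) hit)
    ...   | inj₂ (miss , same′) = inj₁ (trans (sym same′) (trans (sym same) t) , miss)
    backward : ∀ x y → (M x y ≡ true × ¬ (x ≡ p × y ≡ q)) ⊎ (x ≡ p′ × y ≡ q′) →
               swap M p q p′ q′ x y ≡ true
    backward x y (inj₂ (refl , refl)) = update-hit (update M p q false) p′ q′ true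
    backward x y (inj₁ (t , miss)) with update-view (update M p q false) p′ q′ true x y
    ... | inj₁ (_ , _ , hit) = hit
    ... | inj₂ (_ , same) = trans same (trans (update-miss M p q false x y miss) t)

  swapOf-unique : ∀ {M p q p′ q′ P Q} → SwapOf M p q p′ q′ P → SwapOf M p q p′ q′ Q → P ≐ Q
  swapOf-unique (P⇒ , ⇒P) (Q⇒ , ⇒Q) x y =
    bool-ext (λ t → ⇒Q x y (P⇒ x y t)) (λ t → ⇒P x y (Q⇒ x y t))

  swapOf-≐ : ∀ {M p q p′ q′ P Q} → P ≐ Q → SwapOf M p q p′ q′ Q → SwapOf M p q p′ q′ P
  swapOf-≐ P≐Q (Q⇒ , ⇒Q) =
    (λ x y t → Q⇒ x y (trans (sym (P≐Q x y)) t)) , (λ x y h → trans (P≐Q x y) (⇒Q x y h))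

  swapOf-inverse : ∀ {M p q p′ q′ M′} → M p q ≡ true → M p′ q′ ≡ false →
                   SwapOf M p q p′ q′ M′ → SwapOf M′ p′ q′ p q M
  swapOf-inverse {M} {p} {q} {p′} {q′} {M′} Mpq Mp′q′ (M′⇒ , ⇒M′) = forward , backward
    where
    forward : ∀ x y → M x y ≡ true → (M′ x y ≡ true × ¬ (x ≡ p′ × y ≡ q′)) ⊎ (x ≡ p × y ≡ q)
    forward x y t with (x ≟ p) ×-dec (y ≟ q)
    ... | yes at-pq = inj₂ at-pq
    ... | no off-pq = inj₁ (⇒M′ x y (inj₁ (t , off-pq)) , λ { (refl , refl) → not-both t Mp′q′ })
    backward : ∀ x y → (M′ x y ≡ true × ¬ (x ≡ p′ × y ≡ q′)) ⊎ (x ≡ p × y ≡ q) → M x y ≡ true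
    backward x y (inj₂ (refl , refl)) = Mpq
    backward x y (inj₁ (t , off-p′q′)) with M′⇒ x y t
    ... | inj₁ (Mxy , _) = Mxy
    ... | inj₂ at-p′q′ = ⊥-elim (off-p′q′ at-p′q′)

  Between : EdgeSet m n → EdgeSet m n → EdgeSet m n → Set
  Between X Y Z = ∀ a b → Z a b ≡ X a b ⊎ Z a b ≡ Y a b

  swap-between : ∀ M N p q p′ q′ → N p q ≡ false → N p′ q′ ≡ true → Between M N (swap M p q p′ q′)
  swap-between M N p q p′ q′ Npq Np′q′ x y with update-view (update M p q false) p′ q′ true x y
  ... | inj₁ (refl , refl , hit) = inj₂ (trans hit (sym Np′q′))
  ... | inj₂ (_ , same) with update-view M p q false x y
  ...   | inj₁ (refl , refl , hit) = inj₂ (trans same (trans hit (sym Npq)))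
  ...   | inj₂ (_ , same′) = inj₁ (trans same same′)

module Matchings {m n : ℕ} (G : BipGraph m n) where

  matching-⊆ : ∀ {Z X} → Z ⊆ X → IsMatching G X → IsMatching G Z
  matching-⊆ Z⊆X (edges , rows , cols) =
    (λ a b t → edges a b (Z⊆X a b t)) ,
    (λ a b b′ t t′ → rows a b b′ (Z⊆X a b t) (Z⊆X a b′ t′)) ,
    (λ a a′ b t t′ → cols a a′ b (Z⊆X a b t) (Z⊆X a′ b t′))

  matching-insert : ∀ {Z a b} → IsMatching G Z → G a b ≡ true →
                    UncoveredA G Z a → UncoveredB G Z b → IsMatching G (update Z a b true)
  matching-insert {Z} {a} {b} (edges , rows , cols) Gab free-a free-b = edges′ , rows′ , cols′
    where
    Z′ : EdgeSet m n
    Z′ = update Z a b true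
    edges′ : ∀ x y → Z′ x y ≡ true → G x y ≡ true
    edges′ x y t with update-view Z a b true x y
    ... | inj₁ (refl , refl , _) = Gab
    ... | inj₂ (_ , same) = edges x y (trans (sym same) t)
    rows′ : ∀ x y y′ → Z′ x y ≡ true → Z′ x y′ ≡ true → y ≡ y′
    rows′ x y y′ t t′ with update-view Z a b true x y | update-view Z a b true x y′
    ... | inj₁ (_ , y≡b , _) | inj₁ (_ , y′≡b , _) = trans y≡b (sym y′≡b)
    ... | inj₁ (refl , _ , _) | inj₂ (_ , same′) = ⊥-elim (not-both (trans (sym same′) t′) (free-a y′))
    ... | inj₂ (_ , same) | inj₁ (refl , _ , _) = ⊥-elim (not-both (trans (sym same) t) (free-a y))
    ... | inj₂ (_ , same) | inj₂ (_ , same′) = rows x y y′ (trans (sym same) t) (trans (sym same′) t′)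
    cols′ : ∀ x x′ y → Z′ x y ≡ true → Z′ x′ y ≡ true → x ≡ x′
    cols′ x x′ y t t′ with update-view Z a b true x y | update-view Z a b true x′ y
    ... | inj₁ (x≡a , _ , _) | inj₁ (x′≡a , _ , _) = trans x≡a (sym x′≡a)
    ... | inj₁ (_ , refl , _) | inj₂ (_ , same′) = ⊥-elim (not-both (trans (sym same′) t′) (free-b x′))
    ... | inj₂ (_ , same) | inj₁ (_ , refl , _) = ⊥-elim (not-both (trans (sym same) t) (free-b x))
    ... | inj₂ (_ , same) | inj₂ (_ , same′) = cols x x′ y (trans (sym same) t) (trans (sym same′) t′)

  maximum-by-card : ∀ {X Z} → IsMaximumMatching G X → IsMatching G Z → card X ≤ card Z →
                    IsMaximumMatching G Z
  maximum-by-card {X} {Z} (_ , X-max) Z-matching X≤Z = Z-matching , λ M M-matching → begin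
    size G M  ≤⟨ X-max M M-matching ⟩
    size G X  ≡⟨ card-size G X ⟩
    card X    ≤⟨ X≤Z ⟩
    card Z    ≡⟨ card-size G Z ⟨
    size G Z  ∎
    where open ≤-Reasoning

  maximum-≐ : ∀ {Z W} → Z ≐ W → IsMaximumMatching G W → IsMaximumMatching G Z
  maximum-≐ Z≐W W-max@(W-matching , _) =
    maximum-by-card W-max (matching-⊆ (λ a b t → trans (sym (Z≐W a b)) t) W-matching)
      (≤-reflexive (sym (card-≐ Z≐W)))

  no-augmenting-edge : ∀ {X a b} → IsMaximumMatching G X → G a b ≡ true →
                       UncoveredA G X a → UncoveredB G X b → ⊥
  no-augmenting-edge {X} {a} {b} (X-matching , X-max) Gab free-a free-b =
    <-irrefl refl (subst (_≤ card X) (card-insert X a b (free-a b)) bigger≤X)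
    where
    bigger≤X : card (update X a b true) ≤ card X
    bigger≤X = subst₂ _≤_ (card-size G _) (card-size G X)
                 (X-max _ (matching-insert X-matching Gab free-a free-b))

  uncoveredA-⊆ : ∀ {Z X a} → Z ⊆ X → UncoveredA G X a → UncoveredA G Z a
  uncoveredA-⊆ {Z} Z⊆X free b = ¬-not λ t → not-both (Z⊆X _ b t) (free b)

  uncoveredB-⊆ : ∀ {Z X b} → Z ⊆ X → UncoveredB G X b → UncoveredB G Z b
  uncoveredB-⊆ {Z} Z⊆X free a = ¬-not λ t → not-both (Z⊆X a _ t) (free a)

  delete-uncoversA : ∀ {M p q} → IsMatching G M → M p q ≡ true → UncoveredA G (update M p q false) p
  delete-uncoversA {M} {p} {q} (_ , rows , _) Mpq y with update-view M p q false p y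
  ... | inj₁ (_ , _ , hit) = hit
  ... | inj₂ (miss , same) = trans same (¬-not λ t → miss (refl , rows p y q t Mpq))

  delete-uncoversB : ∀ {M p q} → IsMatching G M → M p q ≡ true → UncoveredB G (update M p q false) q
  delete-uncoversB {M} {p} {q} (_ , _ , cols) Mpq x with update-view M p q false x q
  ... | inj₁ (_ , _ , hit) = hit
  ... | inj₂ (miss , same) = trans same (¬-not λ t → miss (cols x p q t Mpq , refl))

  -- Swapping a matching edge for an edge of G whose ends are free after the
  -- deletion keeps a maximum matching maximum: it is a matching of equal size.
  swap-maximum : ∀ {M p q p′ q′} → IsMaximumMatching G M → M p q ≡ true → G p′ q′ ≡ true →
                 UncoveredA G (update M p q false) p′ → UncoveredB G (update M p q false) q′ →
                 IsMaximumMatching G (swap M p q p′ q′)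
  swap-maximum {M} {p} {q} {p′} {q′} M-max@(M-matching , _) Mpq Gp′q′ free-p′ free-q′ =
    maximum-by-card M-max
      (matching-insert (matching-⊆ (delete-⊆ M p q) M-matching) Gp′q′ free-p′ free-q′)
      (≤-reflexive (sym equal-card))
    where
    M-pq : EdgeSet m n
    M-pq = update M p q false
    equal-card : card (swap M p q p′ q′) ≡ card M
    equal-card = trans (card-insert M-pq p′ q′ (free-p′ q′)) (sym (card-delete M p q Mpq))

  exchange-maximum : ∀ {M M′} → Exchange G M M′ → IsMaximumMatching G M′
  exchange-maximum {M} (exchA M-max a a′ b′ free-a Ma′b′ Gab′ M′⇒ ⇒M′) =
    maximum-≐ (swapOf-unique (M′⇒ , ⇒M′) (swap-spec M a′ b′ a b′))
      (swap-maximum M-max Ma′b′ Gab′ (uncoveredA-⊆ (delete-⊆ M a′ b′) free-a)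
         (delete-uncoversB (proj₁ M-max) Ma′b′))
  exchange-maximum {M} (exchB M-max b a′ b′ free-b Ma′b′ Ga′b M′⇒ ⇒M′) =
    maximum-≐ (swapOf-unique (M′⇒ , ⇒M′) (swap-spec M a′ b′ a′ b))
      (swap-maximum M-max Ma′b′ Ga′b (delete-uncoversA (proj₁ M-max) Ma′b′)
         (uncoveredB-⊆ (delete-⊆ M a′ b′) free-b))

  reroute-uncovers : ∀ {M M′ p q q′} → IsMatching G M → M p q ≡ true → M p q′ ≡ false →
                     SwapOf M p q p q′ M′ → UncoveredB G M′ q
  reroute-uncovers {M} {M′} {p} {q} {q′} (_ , _ , cols) Mpq Mpq′ (M′⇒ , _) x =
    ¬-not λ t → absurd (M′⇒ x q t)
    where
    absurd : (M x q ≡ true × ¬ (x ≡ p × q ≡ q)) ⊎ (x ≡ p × q ≡ q′) → ⊥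
    absurd (inj₁ (Mxq , off-pq)) = off-pq (cols x p q Mxq Mpq , refl)
    absurd (inj₂ (_ , refl)) = not-both Mpq Mpq′

closure-map : ∀ {V : Set} {R S : V → V → Set} → (∀ {u v} → R u v → S u v) →
              ∀ {u v} → TransClosure R u v → TransClosure S u v
closure-map f [ r ] = [ f r ]
closure-map f (r ∷ rs) = f r ∷ closure-map f rs

Source : {V : Set} → (V → V → Set) → V → Set
Source R s = (∃ λ w → R s w) × (∀ u → ¬ R u s)

-- A finite acyclic digraph with an arc has a source: walking backwards along
-- arcs must stop, since by pigeonhole a walk with more steps than there are
-- vertices repeats a vertex and so closes a cycle.
module FiniteAcyclic {V : Set} {N : ℕ} (index : V → Fin N)
  (index-injective : ∀ {u v} → index u ≡ index v → u ≡ v)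
  (R : V → V → Set) (predecessor? : ∀ v → (∃ λ u → R u v) ⊎ (∀ u → ¬ R u v))
  (acyclic : ∀ v → ¬ TransClosure R v v) where

  back : V → V
  back v with predecessor? v
  ... | inj₁ (u , _) = u
  ... | inj₂ _ = v

  back-spec : ∀ v → R (back v) v ⊎ (∀ u → ¬ R u v)
  back-spec v with predecessor? v
  ... | inj₁ (_ , r) = inj₁ r
  ... | inj₂ none = inj₂ none

  trail : V → ℕ → V
  trail v zero = v
  trail v (suc i) = back (trail v i)

  Descending : (ℕ → V) → ℕ → Set
  Descending p k = ∀ i → i < k → R (p (suc i)) (p i)

  descending-path : ∀ {p k i j} → Descending p k → i < j → j ≤ k → TransClosure R (p j) (p i)
  descending-path {j = suc j} d i<1+j 1+j≤k with m<1+n⇒m<n∨m≡n i<1+j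
  ... | inj₁ i<j = d j 1+j≤k ∷ descending-path d i<j (<⇒≤ 1+j≤k)
  ... | inj₂ refl = [ d j 1+j≤k ]

  walk : ∀ {u w} → R u w → ∀ k → (∃ (Source R)) ⊎ Descending (trail u) k
  walk r zero = inj₂ λ _ ()
  walk {u} {w} r (suc k) with walk r k
  ... | inj₁ found = inj₁ found
  ... | inj₂ d with back-spec (trail u k)
  ...   | inj₁ r′ = inj₂ λ i i<1+k → extend i (m<1+n⇒m<n∨m≡n i<1+k)
    where
    extend : ∀ i → i < k ⊎ i ≡ k → R (trail u (suc i)) (trail u i)
    extend i (inj₁ i<k) = d i i<k
    extend i (inj₂ refl) = r′
  ...   | inj₂ none = inj₁ (trail u k , outgoing k d , none)
    where
    outgoing : ∀ k → Descending (trail u) k → ∃ λ v → R (trail u k) v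
    outgoing zero _ = w , r
    outgoing (suc k) d = trail u k , d k ≤-refl

  source : ∀ {u w} → R u w → ∃ (Source R)
  source {u} r with walk r (suc N)
  ... | inj₁ found = found
  ... | inj₂ d with pigeonhole (n<1+n N) (index ∘ trail u ∘ toℕ)
  ...   | i , j , i<j , same-index =
          ⊥-elim (acyclic _ (subst (λ v → TransClosure R v (trail u (toℕ i))) (sym repeat) cycle))
    where
    repeat : trail u (toℕ i) ≡ trail u (toℕ j)
    repeat = index-injective same-index
    cycle : TransClosure R (trail u (toℕ j)) (trail u (toℕ i))
    cycle = descending-path d i<j (<⇒≤ (toℕ<n j))

module _ {m n : ℕ} where

  Vertex : Set
  Vertex = Fin m ⊎ Fin n

  data Diff (X Y : EdgeSet m n) : Vertex → Vertex → Set where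
    ins : ∀ a b → Y a b ≡ true → X a b ≡ false → Diff X Y (inj₁ a) (inj₂ b)
    del : ∀ a b → X a b ≡ true → Y a b ≡ false → Diff X Y (inj₂ b) (inj₁ a)

  DiffAcyclic : EdgeSet m n → EdgeSet m n → Set
  DiffAcyclic X Y = ∀ v → ¬ TransClosure (Diff X Y) v v

  diff-predecessor? : ∀ X Y v → (∃ λ u → Diff X Y u v) ⊎ (∀ u → ¬ Diff X Y u v)
  diff-predecessor? X Y (inj₁ a) with any? (λ b → (X a b ≟ᵇ true) ×-dec (Y a b ≟ᵇ false))
  ... | yes (b , Xab , Yab) = inj₁ (inj₂ b , del a b Xab Yab)
  ... | no none = inj₂ λ { _ (del _ b Xab Yab) → none (b , Xab , Yab) }
  diff-predecessor? X Y (inj₂ b) with any? (λ a → (Y a b ≟ᵇ true) ×-dec (X a b ≟ᵇ false))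
  ... | yes (a , Yab , Xab) = inj₁ (inj₁ a , ins a b Yab Xab)
  ... | no none = inj₂ λ { _ (ins a _ Yab Xab) → none (a , Yab , Xab) }

  disagreement-arc : ∀ {X Y a b} → ¬ X a b ≡ Y a b → ∃₂ λ u v → Diff X Y u v
  disagreement-arc {X} {Y} {a} {b} X≢Y with X a b in Xab | Y a b in Yab
  ... | true | false = inj₂ b , inj₁ a , del a b Xab Yab
  ... | false | true = inj₁ a , inj₂ b , ins a b Yab Xab
  ... | true | true = ⊥-elim (X≢Y refl)
  ... | false | false = ⊥-elim (X≢Y refl)

  decide-agreement : ∀ (X Y : EdgeSet m n) → X ≐ Y ⊎ ∃₂ λ a b → ¬ X a b ≡ Y a b
  decide-agreement X Y with any? (λ a → any? λ b → ¬? (X a b ≟ᵇ Y a b))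
  ... | yes (a , b , X≢Y) = inj₂ (a , b , X≢Y)
  ... | no none = inj₁ λ a b → decidable-stable (X a b ≟ᵇ Y a b) λ X≢Y → none (a , b , X≢Y)

  distance : EdgeSet m n → EdgeSet m n → ℕ
  distance X Y = card λ a b → X a b xor Y a b

  Narrows : EdgeSet m n → EdgeSet m n → EdgeSet m n → EdgeSet m n → Set
  Narrows X Y X′ Y′ = ∀ a b → ¬ X′ a b ≡ Y′ a b → X′ a b ≡ X a b × Y′ a b ≡ Y a b

  -- Narrowing keeps the arcs of the difference digraph, hence acyclicity.
  narrows-acyclic : ∀ {X Y X′ Y′} → Narrows X Y X′ Y′ → DiffAcyclic X Y → DiffAcyclic X′ Y′
  narrows-acyclic {X} {Y} {X′} {Y′} nar acyclic v cycle = acyclic v (closure-map arc cycle)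
    where
    arc : ∀ {u v} → Diff X′ Y′ u v → Diff X Y u v
    arc (ins a b Y′ab X′ab) with nar a b (λ X′≡Y′ → not-both (trans X′≡Y′ Y′ab) X′ab)
    ... | X′≡X , Y′≡Y = ins a b (trans (sym Y′≡Y) Y′ab) (trans (sym X′≡X) X′ab)
    arc (del a b X′ab Y′ab) with nar a b (λ X′≡Y′ → not-both X′ab (trans X′≡Y′ Y′ab))
    ... | X′≡X , Y′≡Y = del a b (trans (sym X′≡X) X′ab) (trans (sym Y′≡Y) Y′ab)

  narrows-distance : ∀ {X Y X′ Y′} → Narrows X Y X′ Y′ → ∀ a b →
                     ¬ X a b ≡ Y a b → X′ a b ≡ Y′ a b → distance X′ Y′ < distance X Y
  narrows-distance {X} {Y} {X′} {Y′} nar a b X≢Y X′≡Y′ =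
    card-strict a b fewer (subst (λ v → v xor Y′ a b ≡ false) (sym X′≡Y′) (xor-same (Y′ a b)))
      (differ-xor X≢Y)
    where
    fewer : ∀ x y → X′ x y xor Y′ x y ≡ true → X x y xor Y x y ≡ true
    fewer x y t with nar x y (xor-differ t)
    ... | X′≡X , Y′≡Y = subst₂ (λ u v → u xor v ≡ true) X′≡X Y′≡Y t

  between-narrowsˡ : ∀ {X Y Z} → Between X Y Z → Narrows X Y Z Y
  between-narrowsˡ bt a b Z≢Y with bt a b
  ... | inj₁ Z≡X = Z≡X , refl
  ... | inj₂ Z≡Y = ⊥-elim (Z≢Y Z≡Y)

  between-narrowsʳ : ∀ {X Y Z} → Between Y X Z → Narrows X Y X Z
  between-narrowsʳ bt a b X≢Z with bt a b
  ... | inj₁ Z≡Y = refl , Z≡Y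
  ... | inj₂ Z≡X = ⊥-elim (X≢Z (sym Z≡X))

module Reconfiguration {m n : ℕ} (G : BipGraph m n) where
  open Matchings G

  diff-source : ∀ {X Y u w} → DiffAcyclic X Y → Diff X Y u w → ∃ (Source (Diff X Y))
  diff-source {X} {Y} acyclic =
    FiniteAcyclic.source (join m n) join-injective (Diff X Y) (diff-predecessor? X Y) acyclic
    where
    join-injective : ∀ {u v} → join m n u ≡ join m n v → u ≡ v
    join-injective {u} {v} eq =
      trans (sym (splitAt-join m n u)) (trans (cong (splitAt m) eq) (splitAt-join m n v))

  -- A source a₀ ∈ A is uncovered by X: an X-edge at a₀ outside Y would enter
  -- a₀, and one inside Y would be a₀'s Y-edge, which is not in X.
  sourceA-uncovered : ∀ {X Y a₀ b₁} → IsMatching G Y → Y a₀ b₁ ≡ true → X a₀ b₁ ≡ false →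
                      (∀ u → ¬ Diff X Y u (inj₁ a₀)) → UncoveredA G X a₀
  sourceA-uncovered {X} {Y} {a₀} {b₁} (_ , rows , _) Ya₀b₁ Xa₀b₁ no-entry b = ¬-not λ Xa₀b →
    case-Y Xa₀b (Y a₀ b ≟ᵇ true)
    where
    case-Y : X a₀ b ≡ true → Dec (Y a₀ b ≡ true) → ⊥
    case-Y Xa₀b (yes Ya₀b) =
      not-both (subst (λ v → X a₀ v ≡ true) (rows a₀ b b₁ Ya₀b Ya₀b₁) Xa₀b) Xa₀b₁
    case-Y Xa₀b (no Ya₀b) = no-entry (inj₂ b) (del a₀ b Xa₀b (¬-not Ya₀b))

  sourceB-uncovered : ∀ {X Y a₁ b₀} → IsMatching G X → X a₁ b₀ ≡ true → Y a₁ b₀ ≡ false →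
                      (∀ u → ¬ Diff X Y u (inj₂ b₀)) → UncoveredB G Y b₀
  sourceB-uncovered {X} {Y} {a₁} {b₀} (_ , _ , cols) Xa₁b₀ Ya₁b₀ no-entry a = ¬-not λ Yab₀ →
    case-X Yab₀ (X a b₀ ≟ᵇ true)
    where
    case-X : Y a b₀ ≡ true → Dec (X a b₀ ≡ true) → ⊥
    case-X Yab₀ (yes Xab₀) =
      not-both (subst (λ u → Y u b₀ ≡ true) (cols a a₁ b₀ Xab₀ Xa₁b₀) Yab₀) Ya₁b₀
    case-X Yab₀ (no Xab₀) = no-entry (inj₁ a) (ins a b₀ Yab₀ (¬-not Xab₀))

  record Advance (X Y : EdgeSet m n) : Set where
    field
      next : EdgeSet m n
      exchange : Exchange G X next
      narrows : Narrows X Y next Y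
      closer : distance next Y < distance X Y

  record Retreat (X Y : EdgeSet m n) : Set where
    field
      prev : EdgeSet m n
      maximum : IsMaximumMatching G prev
      narrows : Narrows X Y X prev
      closer : distance X prev < distance X Y
      undo : ∀ W → W ≐ prev → Exchange G W Y

  -- A source a₀ ∈ A with arc a₀ → b₁: b₁ is matched by X to some a₁ (else
  -- a₀b₁ would augment X), and exchanging a₁b₁ for a₀b₁ is an advance.
  advance : ∀ {X Y a₀ b₁} → IsMaximumMatching G X → IsMaximumMatching G Y →
            Y a₀ b₁ ≡ true → X a₀ b₁ ≡ false → (∀ u → ¬ Diff X Y u (inj₁ a₀)) → Advance X Y
  advance {X} {Y} {a₀} {b₁} X-max (Y-matching@(Y-edges , _ , Y-cols) , _) Ya₀b₁ Xa₀b₁ no-entry =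
    partner (any? λ a → X a b₁ ≟ᵇ true)
    where
    free-a₀ : UncoveredA G X a₀
    free-a₀ = sourceA-uncovered Y-matching Ya₀b₁ Xa₀b₁ no-entry
    partner : Dec (∃ λ a → X a b₁ ≡ true) → Advance X Y
    partner (no unmatched) =
      ⊥-elim (no-augmenting-edge X-max (Y-edges a₀ b₁ Ya₀b₁) free-a₀ λ a → ¬-not λ t → unmatched (a , t))
    partner (yes (a₁ , Xa₁b₁)) = record
      { next = swap X a₁ b₁ a₀ b₁
      ; exchange = uncurry′ (exchA X-max a₀ a₁ b₁ free-a₀ Xa₁b₁ (Y-edges a₀ b₁ Ya₀b₁))
                            (swap-spec X a₁ b₁ a₀ b₁)
      ; narrows = narrows
      ; closer = narrows-distance narrows a₀ b₁ (λ X≡Y → not-both (trans X≡Y Ya₀b₁) Xa₀b₁)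
                   (trans (update-hit _ a₀ b₁ true) (sym Ya₀b₁))
      }
      where
      Ya₁b₁ : Y a₁ b₁ ≡ false
      Ya₁b₁ = ¬-not λ t →
        not-both (subst (λ u → X u b₁ ≡ true) (Y-cols a₁ a₀ b₁ t Ya₀b₁) Xa₁b₁) Xa₀b₁
      narrows : Narrows X Y (swap X a₁ b₁ a₀ b₁) Y
      narrows = between-narrowsˡ (swap-between X Y a₁ b₁ a₀ b₁ Ya₁b₁ Ya₀b₁)

  -- A source b₀ ∈ B with arc b₀ → a₁: a₁ is matched by Y to some b₁ (else
  -- a₁b₀ would augment Y); exchanging a₁b₁ for a₁b₀ in Y is a retreat.
  retreat : ∀ {X Y a₁ b₀} → IsMaximumMatching G X → IsMaximumMatching G Y →
            X a₁ b₀ ≡ true → Y a₁ b₀ ≡ false → (∀ u → ¬ Diff X Y u (inj₂ b₀)) → Retreat X Y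
  retreat {X} {Y} {a₁} {b₀} (X-matching@(X-edges , X-rows , _) , _) Y-max@((Y-edges , _) , _)
          Xa₁b₀ Ya₁b₀ no-entry =
    partner (any? λ b → Y a₁ b ≟ᵇ true)
    where
    free-b₀ : UncoveredB G Y b₀
    free-b₀ = sourceB-uncovered X-matching Xa₁b₀ Ya₁b₀ no-entry
    partner : Dec (∃ λ b → Y a₁ b ≡ true) → Retreat X Y
    partner (no unmatched) =
      ⊥-elim (no-augmenting-edge Y-max (X-edges a₁ b₀ Xa₁b₀) (λ b → ¬-not λ t → unmatched (b , t))
                free-b₀)
    partner (yes (b₁ , Ya₁b₁)) = record
      { prev = Y′
      ; maximum = Y′-max
      ; narrows = narrows
      ; closer = narrows-distance narrows a₁ b₀ (λ X≡Y → not-both (trans (sym X≡Y) Xa₁b₀) Ya₁b₀)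
                   (trans Xa₁b₀ (sym (update-hit _ a₁ b₀ true)))
      ; undo = undo
      }
      where
      Y′ : EdgeSet m n
      Y′ = swap Y a₁ b₁ a₁ b₀
      Y′-spec : SwapOf Y a₁ b₁ a₁ b₀ Y′
      Y′-spec = swap-spec Y a₁ b₁ a₁ b₀
      Y′-max : IsMaximumMatching G Y′
      Y′-max = exchange-maximum
        (uncurry′ (exchB Y-max b₀ a₁ b₁ free-b₀ Ya₁b₁ (X-edges a₁ b₀ Xa₁b₀)) Y′-spec)
      Xa₁b₁ : X a₁ b₁ ≡ false
      Xa₁b₁ = ¬-not λ t →
        not-both (subst (λ v → Y a₁ v ≡ true) (X-rows a₁ b₁ b₀ t Xa₁b₀) Ya₁b₁) Ya₁b₀
      narrows : Narrows X Y X Y′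
      narrows = between-narrowsʳ (swap-between Y X a₁ b₁ a₁ b₀ Xa₁b₁ Xa₁b₀)
      undo : ∀ W → W ≐ Y′ → Exchange G W Y
      undo W W≐Y′ =
        uncurry′ (exchB (maximum-≐ W≐Y′ Y′-max) b₁ a₁ b₀
                    (reroute-uncovers (proj₁ Y-max) Ya₁b₁ Ya₁b₀ W-spec)
                    (proj₂ W-spec a₁ b₀ (inj₂ (refl , refl))) (Y-edges a₁ b₁ Ya₁b₁))
          (swapOf-inverse Ya₁b₁ Ya₁b₀ W-spec)
        where
        W-spec : SwapOf Y a₁ b₁ a₁ b₀ W
        W-spec = swapOf-≐ W≐Y′ Y′-spec

  Claim : EdgeSet m n → EdgeSet m n → Set
  Claim X Y = IsMaximumMatching G X → IsMaximumMatching G Y → DiffAcyclic X Y → ArisesByExchanges G X Y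

  Closer : EdgeSet m n → EdgeSet m n → Set
  Closer X Y = ∀ X′ Y′ → distance X′ Y′ < distance X Y → Claim X′ Y′

  via-advance : ∀ {X Y} → IsMaximumMatching G Y → DiffAcyclic X Y → Closer X Y → Advance X Y →
                ArisesByExchanges G X Y
  via-advance Y-max acyclic ih step =
    let W , steps , W≐Y = ih next _ closer (exchange-maximum exchange) Y-max (narrows-acyclic narrows acyclic)
    in W , exchange ◅ steps , W≐Y
    where open Advance step

  via-retreat : ∀ {X Y} → IsMaximumMatching G X → DiffAcyclic X Y → Closer X Y → Retreat X Y →
                ArisesByExchanges G X Y
  via-retreat {X} {Y} X-max acyclic ih step =
    let W , steps , W≐prev = ih X prev closer X-max maximum (narrows-acyclic narrows acyclic)
    in Y , steps ◅◅ (undo W W≐prev ◅ ε) , λ _ _ → refl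
    where open Retreat step

  claim-step : ∀ X Y → Closer X Y → Claim X Y
  claim-step X Y ih X-max Y-max acyclic with decide-agreement X Y
  ... | inj₁ X≐Y = X , ε , X≐Y
  ... | inj₂ (_ , _ , X≢Y) with diff-source acyclic (proj₂ (proj₂ (disagreement-arc X≢Y)))
  ...   | inj₁ a₀ , (_ , ins _ _ Ya₀b₁ Xa₀b₁) , no-entry =
          via-advance Y-max acyclic ih (advance X-max Y-max Ya₀b₁ Xa₀b₁ no-entry)
  ...   | inj₂ b₀ , (_ , del _ _ Xa₁b₀ Ya₁b₀) , no-entry =
          via-retreat X-max acyclic ih (retreat X-max Y-max Xa₁b₀ Ya₁b₀ no-entry)

  claim-bounded : ∀ k X Y → distance X Y < k → Claim X Y
  claim-bounded (suc k) X Y d<1+k =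
    claim-step X Y λ X′ Y′ d′<d → claim-bounded k X′ Y′ (<-≤-trans d′<d (≤-pred d<1+k))

  claim : ∀ X Y → Claim X Y
  claim X Y = claim-bounded (suc (distance X Y)) X Y (n<1+n _)

-- For X = M and Y = M′ the difference digraph is a subdigraph of D(M), hence
-- acyclic, and the claim applies.
lemma13 : (m n : ℕ) (G : BipGraph m n) (M : EdgeSet m n) →
    IsMaximumMatching G M → Acyclic G M →
    (M′ : EdgeSet m n) → IsMaximumMatching G M′ → ArisesByExchanges G M M′
lemma13 m n G M M-max D-acyclic M′ M′-max@((M′-edges , _) , _) =
  Reconfiguration.claim G M M′ M-max M′-max λ v cycle → D-acyclic v (closure-map arc cycle)
  where
  arc : ∀ {u v} → Diff M M′ u v → DArc G M u v
  arc (ins a b M′ab Mab) = a→b a b (M′-edges a b M′ab) Mab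
  arc (del a b Mab _) = b→a a b Mab
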